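{- Let $s$ and $r$ be natural numbers with $2\le s\le r\le 2s-1$, and let $A_r=\{0,1,\dots,r\}$. Call an unordered pair $\{(a,b),(c,d)\}$ of two distinct elements of $A_r\times A_r$ interchangeable if $as+b=cs+d$. Then the number of interchangeable pairs equals $r(r-s+1)$.
   Context: Interchangeable pairs are exactly the pairs of blocks of two consecutive digits that can replace each other in an $r_s$-representation $\sum_{n\ge1}\alpha_n s^{ -n}$ ($\alpha_n\in A_r$) without changing the represented number, since $\frac{a}{s^k}+\frac{b}{s^{k+1}}=\frac{c}{s^k}+\frac{d}{s^{k+1}}$ is equivalent to $as+b=cs+d$. -}

module Defs where

open import Data.Nat using (ℕ; suc; _+_; _*_; _≟_)
open import Data.Product using (_×_; _,_)
open import Data.List using (List; []; _∷_; map; concatMap; upTo; filter; length; _++_)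
open import Relation.Binary.PropositionalEquality using (_≡_)
open import Relation.Nullary using (Dec)

A : ℕ → List ℕ
A r = upTo (suc r)

A² : ℕ → List (ℕ × ℕ)
A² r = concatMap (λ a → map (λ b → (a , b)) (A r)) (A r)

-- all 2-element subsets {x , y} of a duplicate-free list, each listed once
-- (as (x , y) with x occurring before y in the list)
unorderedPairs : {X : Set} → List X → List (X × X)
unorderedPairs [] = []
unorderedPairs (x ∷ xs) = map (λ y → (x , y)) xs ++ unorderedPairs xs

Interchangeable : ℕ → (ℕ × ℕ) × (ℕ × ℕ) → Set
Interchangeable s ((a , b) , (c , d)) = a * s + b ≡ c * s + d

interchangeable? : (s : ℕ) → (p : (ℕ × ℕ) × (ℕ × ℕ)) → Dec (Interchangeable s p)
interchangeable? s ((a , b) , (c , d)) = (a * s + b) ≟ (c * s + d)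

numInterchangeable : ℕ → ℕ → ℕ
numInterchangeable s r = length (filter (interchangeable? s) (unorderedPairs (A² r)))

-- Split A_r × A_r into the rows {(a , b) | b ∈ A_r}. Two elements of one row
-- are never interchangeable, and since b ≤ r < 2s an element (j , b) can only be
-- interchangeable with an element of row j + 1, namely with (j + 1 , b − s) when
-- b ≥ s. So each of the r pairs of consecutive rows contributes r + 1 − s
-- interchangeable pairs.
module Submission where

open import Defs
open import Data.Nat using (ℕ; _≤_; _*_; _+_; _∸_)
open import Relation.Binary.PropositionalEquality using (_≡_)

open import Data.Nat using (zero; suc; _<_; _≤?_; _≟_; s≤s; s≤s⁻¹)
open import Data.Nat.Properties
open import Data.Bool using (true; false)
open import Data.Nat.Solver using (module +-*-Solver)
open import Data.Product using (_×_; _,_; proj₂; uncurry)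
open import Data.List using (List; []; _∷_; [_]; _++_; map; filter; length; concatMap; upTo; cartesianProduct)
open import Data.List.Properties
  using (length-++; filter-++; filter-none; filter-accept; filter-reject; filter-≐;
         ++-identityʳ; concatMap-++; upTo-∷ʳ; cartesianProductWith-distribʳ-++)
open import Data.List.Relation.Unary.Any using (here; there)
open import Data.List.Relation.Unary.All as All using (All; []; _∷_)
import Data.List.Relation.Unary.All.Properties as All
open import Data.List.Relation.Unary.AllPairs as AllPairs using (AllPairs; []; _∷_)
import Data.List.Relation.Unary.AllPairs.Properties as AllPairs
open import Data.List.Relation.Unary.Unique.Propositional using (Unique)
open import Data.List.Relation.Unary.Unique.Propositional.Properties using (upTo⁺)
open import Data.List.Membership.Propositional using (_∈_)
open import Data.List.Membership.Propositional.Properties using (∈-map⁻; ∈-upTo⁺; ∈-upTo⁻; ∈-cartesianProduct⁻)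
open import Function using (_∘_; _⇔_; mk⇔; Equivalence)
open import Relation.Binary.Definitions using (DecidableEquality)
open import Relation.Binary.PropositionalEquality using (_≢_; refl; sym; trans; cong; cong₂; module ≡-Reasoning)
open import Relation.Nullary using (¬_; yes; no; does)
open import Relation.Unary using (∁) renaming (Decidable to Decidable₁)

module _ {A : Set} {P : A → Set} (P? : Decidable₁ P) where

  length-filter-++ : ∀ xs ys →
                     length (filter P? (xs ++ ys)) ≡ length (filter P? xs) + length (filter P? ys)
  length-filter-++ xs ys = trans (cong length (filter-++ P? xs ys)) (length-++ (filter P? xs))

  length-filter-map : ∀ {B : Set} (f : B → A) xs →
                      length (filter P? (map f xs)) ≡ length (filter (P? ∘ f) xs)
  length-filter-map f []       = refl
  length-filter-map f (x ∷ xs) with does (P? (f x))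
  ... | true  = cong suc (length-filter-map f xs)
  ... | false = length-filter-map f xs

  length-filter-none : ∀ {xs} → All (∁ P) xs → length (filter P? xs) ≡ 0
  length-filter-none = cong length ∘ filter-none P?

module _ {A : Set} (_≟ᴬ_ : DecidableEquality A) where

  length-filter-≟-unique : ∀ {c xs} → Unique xs → c ∈ xs → length (filter (c ≟ᴬ_) xs) ≡ 1
  length-filter-≟-unique {c} {x ∷ xs} (x∉xs ∷ _) (here refl) =
    trans (cong length (filter-accept (c ≟ᴬ_) refl)) (cong suc (length-filter-none (c ≟ᴬ_) x∉xs))
  length-filter-≟-unique {c} {x ∷ xs} (x∉xs ∷ xs!) (there c∈xs) = begin
      length (filter (c ≟ᴬ_) (x ∷ xs))  ≡⟨ cong length (filter-reject (c ≟ᴬ_) c≢x) ⟩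
      length (filter (c ≟ᴬ_) xs)        ≡⟨ length-filter-≟-unique xs! c∈xs ⟩
      1                                 ∎
    where
    open ≡-Reasoning
    c≢x : c ≢ x
    c≢x refl = All.lookup x∉xs c∈xs refl

length-filter-≤?-upTo : ∀ s n → length (filter (s ≤?_) (upTo n)) ≡ n ∸ s
length-filter-≤?-upTo s zero    = sym (0∸n≡0 s)
length-filter-≤?-upTo s (suc n) = begin
    length (filter (s ≤?_) (upTo (suc n)))
  ≡⟨ cong (length ∘ filter (s ≤?_)) (sym (upTo-∷ʳ n)) ⟩
    length (filter (s ≤?_) (upTo n ++ [ n ]))
  ≡⟨ length-filter-++ (s ≤?_) (upTo n) [ n ] ⟩
    length (filter (s ≤?_) (upTo n)) + length (filter (s ≤?_) [ n ])
  ≡⟨ cong (_+ length (filter (s ≤?_) [ n ])) (length-filter-≤?-upTo s n) ⟩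
    n ∸ s + length (filter (s ≤?_) [ n ])
  ≡⟨ last-element ⟩
    suc n ∸ s
  ∎
  where
  open ≡-Reasoning
  last-element : n ∸ s + length (filter (s ≤?_) [ n ]) ≡ suc n ∸ s
  last-element with s ≤? n
  ... | yes s≤n = begin
      n ∸ s + length (filter (s ≤?_) [ n ])  ≡⟨ cong (λ ys → n ∸ s + length ys) (filter-accept (s ≤?_) s≤n) ⟩
      n ∸ s + 1                              ≡⟨ +-comm (n ∸ s) 1 ⟩
      suc (n ∸ s)                            ≡⟨ +-∸-assoc 1 s≤n ⟨
      suc n ∸ s                              ∎
  ... | no s≰n = begin
      n ∸ s + length (filter (s ≤?_) [ n ])  ≡⟨ cong (λ ys → n ∸ s + length ys) (filter-reject (s ≤?_) s≰n) ⟩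
      n ∸ s + 0                              ≡⟨ +-identityʳ (n ∸ s) ⟩
      n ∸ s                                  ≡⟨ m≤n⇒m∸n≡0 (<⇒≤ (≰⇒> s≰n)) ⟩
      0                                      ≡⟨ m≤n⇒m∸n≡0 (≰⇒> s≰n) ⟨
      suc n ∸ s                              ∎

unorderedPairs⁺ : {X : Set} {R : X → X → Set} {xs : List X} →
                  AllPairs R xs → All (uncurry R) (unorderedPairs xs)
unorderedPairs⁺ []             = []
unorderedPairs⁺ (Rx∷xs ∷ Rxs) = All.++⁺ (All.map⁺ Rx∷xs) (unorderedPairs⁺ Rxs)

module PairCounting {X : Set} {P : X × X → Set} (P? : Decidable₁ P) where

  pairCount : List X → ℕ
  pairCount xs = length (filter P? (unorderedPairs xs))

  crossCount : List X → List X → ℕ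
  crossCount xs ys = length (filter P? (cartesianProduct xs ys))

  fibreCount : X → List X → ℕ
  fibreCount x ys = length (filter (λ y → P? (x , y)) ys)

  pairCount-∷ : ∀ x xs → pairCount (x ∷ xs) ≡ fibreCount x xs + pairCount xs
  pairCount-∷ x xs = trans (length-filter-++ P? (map (x ,_) xs) (unorderedPairs xs))
                           (cong (_+ pairCount xs) (length-filter-map P? (x ,_) xs))

  crossCount-∷ : ∀ x xs ys → crossCount (x ∷ xs) ys ≡ fibreCount x ys + crossCount xs ys
  crossCount-∷ x xs ys = trans (length-filter-++ P? (map (x ,_) ys) (cartesianProduct xs ys))
                               (cong (_+ crossCount xs ys) (length-filter-map P? (x ,_) ys))

  crossCount-++ˡ : ∀ xs ys zs → crossCount (xs ++ ys) zs ≡ crossCount xs zs + crossCount ys zs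
  crossCount-++ˡ xs ys zs = trans (cong (length ∘ filter P?) (cartesianProductWith-distribʳ-++ _,_ xs ys zs))
                                  (length-filter-++ P? (cartesianProduct xs zs) (cartesianProduct ys zs))

  pairCount-++ : ∀ xs ys → pairCount (xs ++ ys) ≡ pairCount xs + crossCount xs ys + pairCount ys
  pairCount-++ []       ys = refl
  pairCount-++ (x ∷ xs) ys = begin
      pairCount (x ∷ xs ++ ys)
    ≡⟨ pairCount-∷ x (xs ++ ys) ⟩
      fibreCount x (xs ++ ys) + pairCount (xs ++ ys)
    ≡⟨ cong₂ _+_ (length-filter-++ (λ y → P? (x , y)) xs ys) (pairCount-++ xs ys) ⟩
      (fibreCount x xs + fibreCount x ys) + (pairCount xs + crossCount xs ys + pairCount ys)
    ≡⟨ regroup (fibreCount x xs) (fibreCount x ys) (pairCount xs) (crossCount xs ys) (pairCount ys) ⟩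
      (fibreCount x xs + pairCount xs) + (fibreCount x ys + crossCount xs ys) + pairCount ys
    ≡⟨ cong₂ (λ a b → a + b + pairCount ys) (pairCount-∷ x xs) (crossCount-∷ x xs ys) ⟨
      pairCount (x ∷ xs) + crossCount (x ∷ xs) ys + pairCount ys
    ∎
    where
    open ≡-Reasoning
    open +-*-Solver using (solve; _:+_; _:=_)
    regroup : ∀ a b c d e → (a + b) + (c + d + e) ≡ (a + c) + (b + d) + e
    regroup = solve 5 (λ a b c d e → (a :+ b) :+ (c :+ d :+ e) := (a :+ c) :+ (b :+ d) :+ e) refl

  pairCount-none : ∀ {xs} → AllPairs (λ x y → ¬ P (x , y)) xs → pairCount xs ≡ 0
  pairCount-none = length-filter-none P? ∘ unorderedPairs⁺

  crossCount-none : ∀ {xs ys} → (∀ {x y} → x ∈ xs → y ∈ ys → ¬ P (x , y)) → crossCount xs ys ≡ 0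
  crossCount-none {xs} {ys} ¬P =
    length-filter-none P? (All.tabulate (uncurry ¬P ∘ ∈-cartesianProduct⁻ xs ys))

  crossCount-fibres : ∀ {Q : X → Set} (Q? : Decidable₁ Q) {xs ys} →
                      (∀ {x} → x ∈ xs → fibreCount x ys ≡ length (filter Q? [ x ])) →
                      crossCount xs ys ≡ length (filter Q? xs)
  crossCount-fibres Q? {[]}     fibre = refl
  crossCount-fibres Q? {x ∷ xs} {ys} fibre = begin
      crossCount (x ∷ xs) ys
    ≡⟨ crossCount-∷ x xs ys ⟩
      fibreCount x ys + crossCount xs ys
    ≡⟨ cong₂ _+_ (fibre (here refl)) (crossCount-fibres Q? (fibre ∘ there)) ⟩
      length (filter Q? [ x ]) + length (filter Q? xs)
    ≡⟨ length-filter-++ Q? [ x ] xs ⟨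
      length (filter Q? (x ∷ xs))
    ∎
    where open ≡-Reasoning

  pairCount-chain : (f : ℕ → List X) (K : ℕ) →
                    (∀ m → pairCount (f m) ≡ 0) →
                    (∀ {j m} → 2 + j ≤ m → crossCount (f j) (f m) ≡ 0) →
                    (∀ j → crossCount (f j) (f (suc j)) ≡ K) →
                    ∀ n → pairCount (concatMap f (upTo (suc n))) ≡ n * K
  pairCount-chain f K inner distant adjacent = chain
    where
    open ≡-Reasoning

    prefix : ℕ → List X
    prefix n = concatMap f (upTo n)

    prefix-suc : ∀ n → prefix (suc n) ≡ prefix n ++ f n
    prefix-suc n = begin
        concatMap f (upTo (suc n))        ≡⟨ cong (concatMap f) (upTo-∷ʳ n) ⟨
        concatMap f (upTo n ++ [ n ])     ≡⟨ concatMap-++ f (upTo n) [ n ] ⟩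
        prefix n ++ (f n ++ [])           ≡⟨ cong (prefix n ++_) (++-identityʳ (f n)) ⟩
        prefix n ++ f n                   ∎

    crossCount-prefix : ∀ {j m} → suc j ≤ m → crossCount (prefix j) (f m) ≡ 0
    crossCount-prefix {zero}  _      = refl
    crossCount-prefix {suc j} {m} 1+j<m = begin
        crossCount (prefix (suc j)) (f m)
      ≡⟨ cong (λ xs → crossCount xs (f m)) (prefix-suc j) ⟩
        crossCount (prefix j ++ f j) (f m)
      ≡⟨ crossCount-++ˡ (prefix j) (f j) (f m) ⟩
        crossCount (prefix j) (f m) + crossCount (f j) (f m)
      ≡⟨ cong₂ _+_ (crossCount-prefix (<⇒≤ 1+j<m)) (distant 1+j<m) ⟩
        0 + 0
      ∎

    chain : ∀ n → pairCount (prefix (suc n)) ≡ n * K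
    chain zero    = trans (cong pairCount (prefix-suc 0)) (inner 0)
    chain (suc n) = begin
        pairCount (prefix (2 + n))
      ≡⟨ cong pairCount (prefix-suc (suc n)) ⟩
        pairCount (prefix (suc n) ++ f (suc n))
      ≡⟨ pairCount-++ (prefix (suc n)) (f (suc n)) ⟩
        pairCount (prefix (suc n)) + crossCount (prefix (suc n)) (f (suc n)) + pairCount (f (suc n))
      ≡⟨ cong₂ _+_ (cong₂ _+_ (chain n) last-row) (inner (suc n)) ⟩
        n * K + K + 0
      ≡⟨ trans (+-identityʳ (n * K + K)) (+-comm (n * K) K) ⟩
        suc n * K
      ∎
      where
      last-row : crossCount (prefix (suc n)) (f (suc n)) ≡ K
      last-row = begin
          crossCount (prefix (suc n)) (f (suc n))
        ≡⟨ cong (λ xs → crossCount xs (f (suc n))) (prefix-suc n) ⟩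
          crossCount (prefix n ++ f n) (f (suc n))
        ≡⟨ crossCount-++ˡ (prefix n) (f n) (f (suc n)) ⟩
          crossCount (prefix n) (f (suc n)) + crossCount (f n) (f (suc n))
        ≡⟨ cong₂ _+_ (crossCount-prefix {n} ≤-refl) (adjacent n) ⟩
          0 + K
        ∎

j*s+b<m*s+d : ∀ {s j m b} d → b < 2 * s → 2 + j ≤ m → j * s + b < m * s + d
j*s+b<m*s+d {s} {j} {m} {b} d b<2s 2+j≤m = begin-strict
    j * s + b      <⟨ +-monoʳ-< (j * s) b<2s ⟩
    j * s + 2 * s  ≡⟨ +-comm (j * s) (2 * s) ⟩
    2 * s + j * s  ≡⟨ *-distribʳ-+ s 2 j ⟨
    (2 + j) * s    ≤⟨ *-monoˡ-≤ s 2+j≤m ⟩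
    m * s          ≤⟨ m≤m+n (m * s) d ⟩
    m * s + d      ∎
  where open ≤-Reasoning

module Rows (s r : ℕ) where

  open PairCounting (interchangeable? s)

  row : ℕ → List (ℕ × ℕ)
  row a = map (a ,_) (A r)

  pairCount-row : ∀ a → pairCount (row a) ≡ 0
  pairCount-row a =
    pairCount-none (AllPairs.map⁺ (AllPairs.map (λ b≢d → b≢d ∘ +-cancelˡ-≡ (a * s) _ _) (upTo⁺ (suc r))))

  crossCount-distant-rows : r < 2 * s → ∀ {j m} → 2 + j ≤ m → crossCount (row j) (row m) ≡ 0
  crossCount-distant-rows r<2s {j} {m} 2+j≤m = crossCount-none not-interchangeable
    where
    not-interchangeable : ∀ {x y} → x ∈ row j → y ∈ row m → ¬ Interchangeable s (x , y)
    not-interchangeable x∈ y∈ with ∈-map⁻ (j ,_) x∈ | ∈-map⁻ (m ,_) y∈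
    ... | b , b∈A , refl | d , _ , refl =
      <⇒≢ (j*s+b<m*s+d d (≤-<-trans (s≤s⁻¹ (∈-upTo⁻ b∈A)) r<2s) 2+j≤m)

  interchangeable-adjacent⇔ : ∀ j b d → Interchangeable s ((j , b) , (suc j , d)) ⇔ b ≡ s + d
  interchangeable-adjacent⇔ j b d =
    mk⇔ (λ eq → +-cancelˡ-≡ (j * s) b (s + d) (trans eq shift))
        (λ eq → trans (cong (j * s +_) eq) (sym shift))
    where
    shift : suc j * s + d ≡ j * s + (s + d)
    shift = trans (cong (_+ d) (+-comm s (j * s))) (+-assoc (j * s) s d)

  fibreCount-adjacent : ∀ {j b} → b < suc r →
                        fibreCount (j , b) (row (suc j)) ≡ length (filter (s ≤?_) [ b ])
  fibreCount-adjacent {j} {b} b<1+r =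
    trans (length-filter-map (λ y → interchangeable? s ((j , b) , y)) (suc j ,_) (A r)) fibre
    where
    open Equivalence
    partner? : Decidable₁ (λ d → Interchangeable s ((j , b) , (suc j , d)))
    partner? d = interchangeable? s ((j , b) , (suc j , d))

    fibre : length (filter partner? (A r)) ≡ length (filter (s ≤?_) [ b ])
    fibre with s ≤? b
    ... | yes s≤b = begin
        length (filter partner? (A r))    ≡⟨ cong length (filter-≐ partner? (b ∸ s ≟_) (to-∸ , from-∸) (A r)) ⟩
        length (filter (b ∸ s ≟_) (A r))  ≡⟨ length-filter-≟-unique _≟_ (upTo⁺ (suc r)) b∸s∈A ⟩
        1                                 ≡⟨ cong length (filter-accept (s ≤?_) s≤b) ⟨
        length (filter (s ≤?_) [ b ])     ∎
      where
      open ≡-Reasoning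
      to-∸ : ∀ {d} → Interchangeable s ((j , b) , (suc j , d)) → b ∸ s ≡ d
      to-∸ {d} eq = trans (cong (_∸ s) (to (interchangeable-adjacent⇔ j b d) eq)) (m+n∸m≡n s d)
      from-∸ : ∀ {d} → b ∸ s ≡ d → Interchangeable s ((j , b) , (suc j , d))
      from-∸ {d} eq = from (interchangeable-adjacent⇔ j b d) (trans (sym (m+[n∸m]≡n s≤b)) (cong (s +_) eq))
      b∸s∈A : b ∸ s ∈ A r
      b∸s∈A = ∈-upTo⁺ (≤-<-trans (m∸n≤m b s) b<1+r)
    ... | no s≰b = trans (length-filter-none partner? (All.universal no-solution (A r)))
                         (sym (cong length (filter-reject (s ≤?_) s≰b)))
      where
      no-solution : ∀ d → ¬ Interchangeable s ((j , b) , (suc j , d))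
      no-solution d eq = s≰b (≤-trans (m≤m+n s d) (≤-reflexive (sym (to (interchangeable-adjacent⇔ j b d) eq))))

  crossCount-adjacent-rows : ∀ j → crossCount (row j) (row (suc j)) ≡ suc r ∸ s
  crossCount-adjacent-rows j = begin
      crossCount (row j) (row (suc j))    ≡⟨ crossCount-fibres s≤proj₂? {row j} {row (suc j)} fibre ⟩
      length (filter s≤proj₂? (row j))    ≡⟨ length-filter-map s≤proj₂? (j ,_) (A r) ⟩
      length (filter (s ≤?_) (A r))       ≡⟨ length-filter-≤?-upTo s (suc r) ⟩
      suc r ∸ s                           ∎
    where
    open ≡-Reasoning
    s≤proj₂? : Decidable₁ (λ x → s ≤ proj₂ x)
    s≤proj₂? x = s ≤? proj₂ x

    fibre : ∀ {x} → x ∈ row j → fibreCount x (row (suc j)) ≡ length (filter s≤proj₂? [ x ])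
    fibre x∈ with ∈-map⁻ (j ,_) x∈
    ... | b , b∈A , refl =
      trans (fibreCount-adjacent {j} (∈-upTo⁻ b∈A)) (sym (length-filter-map s≤proj₂? (j ,_) [ b ]))

  pairCount-A² : r < 2 * s → pairCount (A² r) ≡ r * (suc r ∸ s)
  pairCount-A² r<2s =
    pairCount-chain row (suc r ∸ s) pairCount-row (crossCount-distant-rows r<2s) crossCount-adjacent-rows r

mainTheorem2 : (s r : ℕ) → 2 ≤ s → s ≤ r → r ≤ 2 * s ∸ 1 →
    numInterchangeable s r ≡ r * (r ∸ s + 1)
mainTheorem2 zero       _ ()    _   _
-- For s = suc _, 2 * s ∸ 1 computes to the predecessor of 2 * s, so s≤s turns
-- r ≤ 2 * s ∸ 1 into r < 2 * s.
mainTheorem2 s@(suc _) r _ s≤r r≤2s∸1 = begin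
    numInterchangeable s r  ≡⟨ Rows.pairCount-A² s r (s≤s r≤2s∸1) ⟩
    r * (suc r ∸ s)         ≡⟨ cong (r *_) (+-∸-assoc 1 s≤r) ⟩
    r * suc (r ∸ s)         ≡⟨ cong (r *_) (+-comm 1 (r ∸ s)) ⟩
    r * (r ∸ s + 1)         ∎
  where open ≡-Reasoning
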